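{- For every positive integer $d$, the cover pebbling number of the $d$-dimensional hypercube $Q^d$ satisfies $\gamma(Q^d)=3^d$.
   Context: The $d$-dimensional hypercube $Q^d$ has vertex set $\{0,1\}^d$, two vertices being adjacent iff they differ in exactly one coordinate. A configuration of pebbles on a graph $G$ is a function $C:V(G)\to\{0,1,2,\ldots\}$; its size is $|C|=\sum_{x}C(x)$. A pebbling step removes two pebbles from one vertex and places one pebble on an adjacent vertex. The cover pebbling number $\gamma(G)$ is the minimum number $m$ such that every configuration of size $m$ has the property that, after some sequence of pebbling steps, every vertex has at least one pebble on it. -}

module Defs where

open import Data.Nat using (ℕ; zero; suc; _+_; _∸_; _≤_; _<_)
open import Data.Bool using (Bool; true; false; not)
open import Data.Fin using (Fin)
open import Data.Vec using (Vec; []; _∷_; _[_]%=_)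
open import Data.Vec.Properties using (≡-dec)
open import Data.Bool.Properties using (_≟_)
open import Data.List using (List; []; _∷_; map; _++_)
open import Data.Nat.ListAction using (sum)
open import Data.Product using (Σ; ∃; _×_; _,_)
open import Relation.Nullary using (¬_; yes; no)
open import Relation.Binary.PropositionalEquality using (_≡_)
open import Relation.Binary.Construct.Closure.ReflexiveTransitive using (Star)

Vertex : ℕ → Set
Vertex d = Vec Bool d

Adj : ∀ {d} → Vertex d → Vertex d → Set
Adj {d} x y = ∃ λ (i : Fin d) → y ≡ (x [ i ]%= not)

allVertices : (d : ℕ) → List (Vertex d)
allVertices zero = [] ∷ []
allVertices (suc d) = map (false ∷_) (allVertices d) ++ map (true ∷_) (allVertices d)

Config : ℕ → Set
Config d = Vertex d → ℕ

size : ∀ {d} → Config d → ℕ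
size {d} C = sum (map C (allVertices d))

at : ∀ {d} → Vertex d → Vertex d → ℕ → ℕ
at u w k with ≡-dec _≟_ w u
... | yes _ = k
... | no _ = 0

Step : ∀ {d} → Config d → Config d → Set
Step {d} C C′ = Σ (Vertex d) λ u → Σ (Vertex d) λ v →
  Adj u v × 2 ≤ C u × (∀ w → C′ w ≡ (C w ∸ at u w 2) + at v w 1)

Reachable : ∀ {d} → Config d → Config d → Set
Reachable = Star Step

Coverable : ∀ {d} → Config d → Set
Coverable {d} C = ∃ λ C′ → Reachable C C′ × (∀ w → 1 ≤ C′ w)

AllCoverable : (d m : ℕ) → Set
AllCoverable d m = ∀ (C : Config d) → size C ≡ m → Coverable C

IsCoverPebblingNumber : (d m : ℕ) → Set
IsCoverPebblingNumber d m = AllCoverable d m × (∀ k → k < m → ¬ AllCoverable d k)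

-- Lower bound: give a pebble on w the potential 2^|w|, |w| the number of ones of w. A pebbling
-- step from u to a neighbour v trades potential 2·2^|u| for 2^|v| ≤ 2·2^|u|, so potential never
-- increases. k pebbles on 0…0 have potential k, while a covered configuration has potential at
-- least Σ_w 2^|w| = 3^d.
--
-- Upper bound, by induction on d: split Q^(d+1) into the two copies of Q^d along the first
-- coordinate. While one half holds fewer than 3^d pebbles, move pebbles across, two for one;
-- this keeps (pebbles on the other half) + 2·(pebbles on this half) ≥ 3·3^d, which guarantees
-- both a vertex with two pebbles to move and, at the end, 3^d pebbles on each half. Each half
-- is then covered by induction.
module Submission where

open import Defs
open import Data.Nat using (ℕ; _≤_; _^_)
open import Data.Nat using (zero; suc; _+_; _*_; _∸_; _<_; z≤n; s≤s; _≤?_)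
open import Data.Nat.Properties hiding (_≟_)
open import Data.Nat.Tactic.RingSolver using (solve-∀)
open import Algebra.Properties.CommutativeSemigroup +-commutativeSemigroup using (interchange)
open import Data.Bool using (Bool; true; false; not)
open import Data.Bool.Properties using (_≟_; not-¬)
open import Data.Fin using (zero; suc)
open import Data.Vec using ([]; _∷_; replicate; _[_]%=_)
open import Data.Vec.Properties using (≡-dec; ∷-injectiveˡ; ∷-injectiveʳ)
open import Data.List using ([]; _∷_; map; _++_; length)
open import Data.List.Properties using (map-++; map-∘; map-cong; length-++; length-map)
open import Data.Nat.ListAction using (sum)
open import Data.Nat.ListAction.Properties using (sum-++)
open import Data.Product using (∃; _×_; _,_)
open import Data.Sum using (_⊎_; inj₁; inj₂)
open import Data.Empty using (⊥-elim)
open import Function using (_∘_)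
open import Relation.Nullary using (¬_; Dec; yes; no)
open import Relation.Binary.PropositionalEquality
open import Relation.Binary.Construct.Closure.ReflexiveTransitive using (ε; _◅_; _◅◅_; gmap)

module _ {A : Set} where

  sum-map-cong : ∀ {f g : A → ℕ} → f ≗ g → ∀ xs → sum (map f xs) ≡ sum (map g xs)
  sum-map-cong f≗g xs = cong sum (map-cong f≗g xs)

  sum-map-+ : ∀ (f g : A → ℕ) xs →
    sum (map (λ x → f x + g x) xs) ≡ sum (map f xs) + sum (map g xs)
  sum-map-+ f g []       = refl
  sum-map-+ f g (x ∷ xs) =
    trans (cong (f x + g x +_) (sum-map-+ f g xs)) (interchange (f x) (g x) _ _)

  sum-map-*ˡ : ∀ k (f : A → ℕ) xs → sum (map (λ x → k * f x) xs) ≡ k * sum (map f xs)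
  sum-map-*ˡ k f []       = sym (*-zeroʳ k)
  sum-map-*ˡ k f (x ∷ xs) =
    trans (cong (k * f x +_) (sum-map-*ˡ k f xs)) (sym (*-distribˡ-+ k (f x) _))

  sum-map-≡0 : ∀ {f : A → ℕ} → (∀ x → f x ≡ 0) → ∀ xs → sum (map f xs) ≡ 0
  sum-map-≡0 f≡0 []       = refl
  sum-map-≡0 f≡0 (x ∷ xs) = cong₂ _+_ (f≡0 x) (sum-map-≡0 f≡0 xs)

  sum-map-mono : ∀ {f g : A → ℕ} → (∀ x → f x ≤ g x) → ∀ xs →
    sum (map f xs) ≤ sum (map g xs)
  sum-map-mono f≤g []       = z≤n
  sum-map-mono f≤g (x ∷ xs) = +-mono-≤ (f≤g x) (sum-map-mono f≤g xs)

  sum-map≤length⊎∃2≤ : ∀ (f : A → ℕ) xs →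
    sum (map f xs) ≤ length xs ⊎ ∃ λ x → 2 ≤ f x
  sum-map≤length⊎∃2≤ f []       = inj₁ z≤n
  sum-map≤length⊎∃2≤ f (x ∷ xs) with f x ≤? 1 | sum-map≤length⊎∃2≤ f xs
  ... | yes fx≤1 | inj₁ ≤length = inj₁ (+-mono-≤ fx≤1 ≤length)
  ... | yes _    | inj₂ big     = inj₂ big
  ... | no fx≰1  | _            = inj₂ (x , ≰⇒> fx≰1)

m∸n+o+n≡m+o : ∀ {m n} o → n ≤ m → m ∸ n + o + n ≡ m + o
m∸n+o+n≡m+o {m} {n} o n≤m = begin
  m ∸ n + o + n   ≡⟨ +-assoc (m ∸ n) o n ⟩
  m ∸ n + (o + n) ≡⟨ cong (m ∸ n +_) (+-comm o n) ⟩
  m ∸ n + (n + o) ≡⟨ sym (+-assoc (m ∸ n) n o) ⟩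
  m ∸ n + n + o   ≡⟨ cong (_+ o) (m∸n+n≡m n≤m) ⟩
  m + o           ∎
  where open ≡-Reasoning

∀-from-b-not-b : ∀ {P : Bool → Set} b → P b → P (not b) → ∀ c → P c
∀-from-b-not-b false Pb Pnb false = Pb
∀-from-b-not-b false Pb Pnb true  = Pnb
∀-from-b-not-b true  Pb Pnb false = Pnb
∀-from-b-not-b true  Pb Pnb true  = Pb

half : ∀ {d} → Bool → Config (suc d) → Config d
half b C y = C (b ∷ y)

join : ∀ {d} → Config d → Config d → Config (suc d)
join A B (false ∷ y) = A y
join A B (true  ∷ y) = B y

size-cong : ∀ {d} {f g : Config d} → f ≗ g → size f ≡ size g
size-cong {d} f≗g = sum-map-cong f≗g (allVertices d)

size-≡0 : ∀ {d} {f : Config d} → (∀ w → f w ≡ 0) → size f ≡ 0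
size-≡0 {d} f≡0 = sum-map-≡0 f≡0 (allVertices d)

size-+ : ∀ {d} {A P B Q : Config d} → (∀ w → A w + P w ≡ B w + Q w) →
  size A + size P ≡ size B + size Q
size-+ {d} {A} {P} {B} {Q} eq =
  trans (sym (sum-map-+ A P vs)) (trans (sum-map-cong eq vs) (sum-map-+ B Q vs))
  where vs = allVertices d

size-split : ∀ {d} (f : Config (suc d)) → size f ≡ size (half false f) + size (half true f)
size-split {d} f = begin
  sum (map f (map (false ∷_) vs ++ map (true ∷_) vs))
    ≡⟨ cong sum (map-++ f (map (false ∷_) vs) (map (true ∷_) vs)) ⟩
  sum (map f (map (false ∷_) vs) ++ map f (map (true ∷_) vs))
    ≡⟨ sum-++ (map f (map (false ∷_) vs)) (map f (map (true ∷_) vs)) ⟩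
  sum (map f (map (false ∷_) vs)) + sum (map f (map (true ∷_) vs))
    ≡⟨ cong₂ _+_ (cong sum (sym (map-∘ vs))) (cong sum (sym (map-∘ vs))) ⟩
  size (half false f) + size (half true f) ∎
  where
  open ≡-Reasoning
  vs = allVertices d

size-split′ : ∀ {d} b (f : Config (suc d)) → size f ≡ size (half b f) + size (half (not b) f)
size-split′ false f = size-split f
size-split′ true  f = trans (size-split f) (+-comm (size (half false f)) (size (half true f)))

length-allVertices : ∀ d → length (allVertices d) ≡ 2 ^ d
length-allVertices zero    = refl
length-allVertices (suc d) = begin
  length (map (false ∷_) vs ++ map (true ∷_) vs)
    ≡⟨ length-++ (map (false ∷_) vs) ⟩
  length (map (false ∷_) vs) + length (map (true ∷_) vs)
    ≡⟨ cong₂ _+_ (length-map _ vs) (length-map _ vs) ⟩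
  length vs + length vs
    ≡⟨ cong₂ _+_ ih (trans ih (sym (+-identityʳ _))) ⟩
  2 ^ suc d ∎
  where
  open ≡-Reasoning
  vs = allVertices d
  ih = length-allVertices d

2^d<size⇒∃2≤ : ∀ {d} (C : Config d) → 2 ^ d < size C → ∃ λ w → 2 ≤ C w
2^d<size⇒∃2≤ {d} C 2^d<size with sum-map≤length⊎∃2≤ C (allVertices d)
... | inj₁ size≤length =
  ⊥-elim (<⇒≱ 2^d<size (≤-trans size≤length (≤-reflexive (length-allVertices d))))
... | inj₂ big         = big

at-≡ : ∀ {d} (u w : Vertex d) k → w ≡ u → at u w k ≡ k
at-≡ u w k w≡u with ≡-dec _≟_ w u
... | yes _   = refl
... | no w≢u = ⊥-elim (w≢u w≡u)

at-≢ : ∀ {d} (u w : Vertex d) k → w ≢ u → at u w k ≡ 0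
at-≢ u w k w≢u with ≡-dec _≟_ w u
... | yes w≡u = ⊥-elim (w≢u w≡u)
... | no _    = refl

at-∷ : ∀ {d} b (u w : Vertex d) k → at (b ∷ u) (b ∷ w) k ≡ at u w k
at-∷ b u w k = by-cases (≡-dec _≟_ w u)
  where
  by-cases : Dec (w ≡ u) → at (b ∷ u) (b ∷ w) k ≡ at u w k
  by-cases (yes w≡u) =
    trans (at-≡ (b ∷ u) (b ∷ w) k (cong (b ∷_) w≡u)) (sym (at-≡ u w k w≡u))
  by-cases (no w≢u)  =
    trans (at-≢ (b ∷ u) (b ∷ w) k (w≢u ∘ ∷-injectiveʳ)) (sym (at-≢ u w k w≢u))

at-∷-≢ : ∀ {d} b c (u w : Vertex d) k → c ≢ b → at (b ∷ u) (c ∷ w) k ≡ 0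
at-∷-≢ b c u w k c≢b = at-≢ _ _ k (c≢b ∘ ∷-injectiveˡ)

size-at-* : ∀ {d} (u : Vertex d) k (g : Config d) → size (λ w → at u w k * g w) ≡ k * g u
size-at-* [] k g = trans (+-identityʳ _) (cong (_* g []) (at-≡ [] [] k refl))
size-at-* (b ∷ u) k g = begin
  size (λ w → at (b ∷ u) w k * g w)
    ≡⟨ size-split′ b (λ w → at (b ∷ u) w k * g w) ⟩
  size (λ y → at (b ∷ u) (b ∷ y) k * g (b ∷ y))
    + size (λ y → at (b ∷ u) (not b ∷ y) k * g (not b ∷ y))
    ≡⟨ cong₂ _+_ (size-cong λ y → cong (_* g (b ∷ y)) (at-∷ b u y k))
                 (size-≡0 λ y → cong (_* g (not b ∷ y)) (at-∷-≢ b (not b) u y k (not-¬ refl ∘ sym))) ⟩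
  size (λ y → at u y k * g (b ∷ y)) + 0
    ≡⟨ +-identityʳ _ ⟩
  size (λ y → at u y k * g (b ∷ y))
    ≡⟨ size-at-* u k (half b g) ⟩
  k * g (b ∷ u) ∎
  where open ≡-Reasoning

size-at : ∀ {d} (u : Vertex d) k → size (λ w → at u w k) ≡ k
size-at u k = begin
  size (λ w → at u w k)     ≡⟨ size-cong (λ w → sym (*-identityʳ (at u w k))) ⟩
  size (λ w → at u w k * 1) ≡⟨ size-at-* u k (λ _ → 1) ⟩
  k * 1                     ≡⟨ *-identityʳ k ⟩
  k                         ∎
  where open ≡-Reasoning

size-at-∷ : ∀ {d} b (u : Vertex d) k → size (λ y → at (b ∷ u) (b ∷ y) k) ≡ k
size-at-∷ b u k = trans (size-cong (λ y → at-∷ b u y k)) (size-at u k)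

size-at-∷-≢ : ∀ {d} {b c} (u : Vertex d) k → c ≢ b →
  size (λ y → at (b ∷ u) (c ∷ y) k) ≡ 0
size-at-∷-≢ {b = b} {c} u k c≢b = size-≡0 (λ y → at-∷-≢ b c u y k c≢b)

size-+-at-* : ∀ {d} {A B : Config d} {u v k l} → (∀ w → A w + at u w k ≡ B w + at v w l) →
  ∀ g → size (λ w → A w * g w) + k * g u ≡ size (λ w → B w * g w) + l * g v
size-+-at-* {A = A} {B} {u} {v} {k} {l} balanced g = begin
  size (λ w → A w * g w) + k * g u
    ≡⟨ cong (size (λ w → A w * g w) +_) (sym (size-at-* u k g)) ⟩
  size (λ w → A w * g w) + size (λ w → at u w k * g w)
    ≡⟨ size-+ weighted ⟩
  size (λ w → B w * g w) + size (λ w → at v w l * g w)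
    ≡⟨ cong (size (λ w → B w * g w) +_) (size-at-* v l g) ⟩
  size (λ w → B w * g w) + l * g v ∎
  where
  open ≡-Reasoning
  weighted : ∀ w → A w * g w + at u w k * g w ≡ B w * g w + at v w l * g w
  weighted w = trans (sym (*-distribʳ-+ (g w) (A w) (at u w k)))
                 (trans (cong (_* g w) (balanced w)) (*-distribʳ-+ (g w) (B w) (at v w l)))

move : ∀ {d} → Vertex d → Vertex d → Config d → Config d
move u v C w = (C w ∸ at u w 2) + at v w 1

move-Step : ∀ {d} {C : Config d} {u v} → Adj u v → 2 ≤ C u → Step C (move u v C)
move-Step {u = u} {v} adj 2≤Cu = u , v , adj , 2≤Cu , λ _ → refl

Step-balance : ∀ {d} {C C′ : Config d} {u v} → 2 ≤ C u →
  (∀ w → C′ w ≡ (C w ∸ at u w 2) + at v w 1) → ∀ w → C′ w + at u w 2 ≡ C w + at v w 1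
Step-balance {u = u} {v} 2≤Cu C′≡ w rewrite C′≡ w with ≡-dec _≟_ w u
... | yes refl = m∸n+o+n≡m+o (at v u 1) 2≤Cu
... | no _     = +-identityʳ _

Step-respˡ-≗ : ∀ {d} {C D C′ : Config d} → C ≗ D → Step C C′ → Step D C′
Step-respˡ-≗ C≗D (u , v , adj , 2≤Cu , C′≡) =
  u , v , adj , subst (2 ≤_) (C≗D u) 2≤Cu ,
  λ w → trans (C′≡ w) (cong (λ n → (n ∸ at u w 2) + at v w 1) (C≗D w))

Coverable-resp-≗ : ∀ {d} {C D : Config d} → C ≗ D → Coverable C → Coverable D
Coverable-resp-≗ {D = D} C≗D (_ , ε , covered) =
  D , ε , λ w → subst (1 ≤_) (C≗D w) (covered w)
Coverable-resp-≗ C≗D (E , s ◅ r , covered) = E , Step-respˡ-≗ C≗D s ◅ r , covered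

Reachable-Coverable : ∀ {d} {C C′ : Config d} → Reachable C C′ → Coverable C′ → Coverable C
Reachable-Coverable r (E , r′ , covered) = E , r ◅◅ r′ , covered

-- Potential

weight : ∀ {d} → Vertex d → ℕ
weight []          = 0
weight (false ∷ w) = weight w
weight (true  ∷ w) = suc (weight w)

weight-flip : ∀ {d} (u : Vertex d) i → weight (u [ i ]%= not) ≤ suc (weight u)
weight-flip (false ∷ u) zero    = ≤-refl
weight-flip (true  ∷ u) zero    = ≤-trans (n≤1+n _) (n≤1+n _)
weight-flip (false ∷ u) (suc i) = weight-flip u i
weight-flip (true  ∷ u) (suc i) = s≤s (weight-flip u i)

mass : ∀ {d} → Vertex d → ℕ
mass w = 2 ^ weight w

potential : ∀ {d} → Config d → ℕ
potential C = size (λ w → C w * mass w)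

size-mass : ∀ d → size {d} mass ≡ 3 ^ d
size-mass zero    = refl
size-mass (suc d) =
  trans (size-split (mass {suc d}))
    (cong₂ _+_ (size-mass d) (trans (sum-map-*ˡ 2 mass (allVertices d)) (cong (2 *_) (size-mass d))))

potential-Step : ∀ {d} {C C′ : Config d} → Step C C′ → potential C′ ≤ potential C
potential-Step {C = C} {C′} (u , _ , (i , refl) , 2≤Cu , C′≡) =
  +-cancelʳ-≤ (2 * mass u) (potential C′) (potential C) (begin
    potential C′ + 2 * mass u
      ≡⟨ size-+-at-* (Step-balance 2≤Cu C′≡) mass ⟩
    potential C + 1 * mass (u [ i ]%= not)
      ≡⟨ cong (potential C +_) (*-identityˡ _) ⟩
    potential C + mass (u [ i ]%= not)
      ≤⟨ +-monoʳ-≤ (potential C) (^-monoʳ-≤ 2 (weight-flip u i)) ⟩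
    potential C + 2 * mass u ∎)
  where open ≤-Reasoning

potential-Reachable : ∀ {d} {C C′ : Config d} → Reachable C C′ → potential C′ ≤ potential C
potential-Reachable ε       = ≤-refl
potential-Reachable (s ◅ r) = ≤-trans (potential-Reachable r) (potential-Step s)

3^d≤potential : ∀ {d} {C : Config d} → (∀ w → 1 ≤ C w) → 3 ^ d ≤ potential C
3^d≤potential {d} {C} covered =
  subst (_≤ potential C) (size-mass d)
    (sum-map-mono mass≤ (allVertices d))
  where
  mass≤ : ∀ w → mass w ≤ C w * mass w
  mass≤ w = ≤-trans (≤-reflexive (sym (*-identityˡ (mass w)))) (*-monoˡ-≤ (mass w) (covered w))

origin : ∀ d → Vertex d
origin d = replicate d false

weight-origin : ∀ d → weight (origin d) ≡ 0
weight-origin zero    = refl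
weight-origin (suc d) = weight-origin d

potential-at-origin : ∀ d k → potential (λ w → at (origin d) w k) ≡ k
potential-at-origin d k =
  trans (size-at-* (origin d) k mass)
    (trans (cong (λ n → k * 2 ^ n) (weight-origin d)) (*-identityʳ k))

¬AllCoverable : ∀ d k → k < 3 ^ d → ¬ AllCoverable d k
¬AllCoverable d k k<3^d allCoverable
  with allCoverable (λ w → at (origin d) w k) (size-at (origin d) k)
... | C′ , r , covered = <⇒≱ k<3^d (begin
  3 ^ d                              ≤⟨ 3^d≤potential covered ⟩
  potential C′                       ≤⟨ potential-Reachable r ⟩
  potential (λ w → at (origin d) w k) ≡⟨ potential-at-origin d k ⟩
  k                                  ∎)
  where open ≤-Reasoning

-- Covering Q^(d+1) half by half

Step-joinˡ : ∀ {d} (B : Config d) {A A′ : Config d} →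
  Step A A′ → Step (join A B) (join A′ B)
Step-joinˡ B (u , v , (i , v≡) , 2≤Au , A′≡) =
  false ∷ u , false ∷ v , (suc i , cong (false ∷_) v≡) , 2≤Au , joined
  where
  joined : ∀ w → join _ B w ≡ (join _ B w ∸ at (false ∷ u) w 2) + at (false ∷ v) w 1
  joined (false ∷ y) rewrite at-∷ false u y 2 | at-∷ false v y 1 = A′≡ y
  joined (true ∷ y)  rewrite at-∷-≢ false true u y 2 (λ ()) | at-∷-≢ false true v y 1 (λ ()) =
    sym (+-identityʳ (B y))

Step-joinʳ : ∀ {d} (A : Config d) {B B′ : Config d} →
  Step B B′ → Step (join A B) (join A B′)
Step-joinʳ A (u , v , (i , v≡) , 2≤Bu , B′≡) =
  true ∷ u , true ∷ v , (suc i , cong (true ∷_) v≡) , 2≤Bu , joined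
  where
  joined : ∀ w → join A _ w ≡ (join A _ w ∸ at (true ∷ u) w 2) + at (true ∷ v) w 1
  joined (false ∷ y) rewrite at-∷-≢ true false u y 2 (λ ()) | at-∷-≢ true false v y 1 (λ ()) =
    sym (+-identityʳ (A y))
  joined (true ∷ y)  rewrite at-∷ true u y 2 | at-∷ true v y 1 = B′≡ y

join-half : ∀ {d} (C : Config (suc d)) → join (half false C) (half true C) ≗ C
join-half C (false ∷ y) = refl
join-half C (true  ∷ y) = refl

Coverable-halves : ∀ {d} T → (∀ (A : Config d) → T ≤ size A → Coverable A) →
  (C : Config (suc d)) → (∀ b → T ≤ size (half b C)) → Coverable C
Coverable-halves T cover C big with cover (half false C) (big false) | cover (half true C) (big true)
... | A₀ , r₀ , covered₀ | A₁ , r₁ , covered₁ =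
  Coverable-resp-≗ (join-half C)
    (join A₀ A₁ ,
     gmap (λ A → join A (half true C)) (Step-joinˡ (half true C)) r₀
       ◅◅ gmap (join A₀) (Step-joinʳ A₀) r₁ ,
     covered)
  where
  covered : ∀ w → 1 ≤ join A₀ A₁ w
  covered (false ∷ y) = covered₀ y
  covered (true  ∷ y) = covered₁ y

-- Moving pebbles between the halves

size-half-move : ∀ {d} b (x : Vertex d) (C : Config (suc d)) → 2 ≤ C (b ∷ x) → ∀ c →
  size (half c (move (b ∷ x) (not b ∷ x) C)) + size (λ y → at (b ∷ x) (c ∷ y) 2)
    ≡ size (half c C) + size (λ y → at (not b ∷ x) (c ∷ y) 1)
size-half-move b x C 2≤C c = size-+ (λ y → Step-balance {C = C} 2≤C (λ _ → refl) (c ∷ y))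

size-half-move-from : ∀ {d} b (x : Vertex d) (C : Config (suc d)) → 2 ≤ C (b ∷ x) →
  size (half b (move (b ∷ x) (not b ∷ x) C)) + 2 ≡ size (half b C)
size-half-move-from b x C 2≤C = begin
  s′ + 2
    ≡⟨ cong (s′ +_) (sym (size-at-∷ b x 2)) ⟩
  s′ + size (λ y → at (b ∷ x) (b ∷ y) 2)
    ≡⟨ size-half-move b x C 2≤C b ⟩
  size (half b C) + size (λ y → at (not b ∷ x) (b ∷ y) 1)
    ≡⟨ cong (size (half b C) +_) (size-at-∷-≢ x 1 (not-¬ {b} refl)) ⟩
  size (half b C) + 0
    ≡⟨ +-identityʳ _ ⟩
  size (half b C) ∎
  where
  open ≡-Reasoning
  s′ = size (half b (move (b ∷ x) (not b ∷ x) C))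

size-half-move-to : ∀ {d} b (x : Vertex d) (C : Config (suc d)) → 2 ≤ C (b ∷ x) →
  size (half (not b) (move (b ∷ x) (not b ∷ x) C)) ≡ size (half (not b) C) + 1
size-half-move-to b x C 2≤C = begin
  s′
    ≡⟨ sym (+-identityʳ s′) ⟩
  s′ + 0
    ≡⟨ cong (s′ +_) (sym (size-at-∷-≢ x 2 (not-¬ {b} refl ∘ sym))) ⟩
  s′ + size (λ y → at (b ∷ x) (not b ∷ y) 2)
    ≡⟨ size-half-move b x C 2≤C (not b) ⟩
  size (half (not b) C) + size (λ y → at (not b ∷ x) (not b ∷ y) 1)
    ≡⟨ cong (size (half (not b) C) +_) (size-at-∷ (not b) x 1) ⟩
  size (half (not b) C) + 1 ∎
  where
  open ≡-Reasoning
  s′ = size (half (not b) (move (b ∷ x) (not b ∷ x) C))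

3[a+1+n]≤s+2a⇒a+1+n<s : ∀ a n s → 3 * (a + suc n) ≤ s + 2 * a → a + suc n < s
3[a+1+n]≤s+2a⇒a+1+n<s a n s ≤s+2a =
  ≤-trans (m≤m+n _ _) (+-cancelʳ-≤ (2 * a) _ s (subst (_≤ s + 2 * a) (regroup a n) ≤s+2a))
  where
  regroup : ∀ a n → 3 * (a + suc n) ≡ suc (a + suc n) + (n + suc n) + 2 * a
  regroup = solve-∀

fill-half : ∀ {d} T → 2 ^ d ≤ T → ∀ b n (C : Config (suc d)) →
  size (half (not b) C) + n ≡ T →
  3 * T ≤ size (half b C) + 2 * size (half (not b) C) →
  ∃ λ C′ → Reachable C C′ × (∀ c → T ≤ size (half c C′))
fill-half _ _ b zero C snb+0≡T ≤sb+2snb with trans (sym (+-identityʳ _)) snb+0≡T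
... | refl =
  C , ε , ∀-from-b-not-b b (+-cancelʳ-≤ (2 * snb) snb (size (half b C)) ≤sb+2snb) ≤-refl
  where snb = size (half (not b) C)
fill-half T 2^d≤T b (suc n) C refl ≤sb+2snb
  with 2^d<size⇒∃2≤ (half b C)
         (≤-trans (s≤s 2^d≤T) (3[a+1+n]≤s+2a⇒a+1+n<s _ n _ ≤sb+2snb))
... | x , 2≤C with fill-half T 2^d≤T b n C′ filled invariant
  where
  C′ = move (b ∷ x) (not b ∷ x) C
  to = size-half-move-to b x C 2≤C
  filled : size (half (not b) C′) + n ≡ T
  filled = trans (cong (_+ n) to) (+-assoc _ 1 n)
  invariant : 3 * T ≤ size (half b C′) + 2 * size (half (not b) C′)
  invariant = subst (3 * T ≤_) preserved ≤sb+2snb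
    where
    regroup : ∀ a c → a + 2 + 2 * c ≡ a + 2 * (c + 1)
    regroup = solve-∀
    preserved : size (half b C) + 2 * size (half (not b) C)
              ≡ size (half b C′) + 2 * size (half (not b) C′)
    preserved = begin
      size (half b C) + 2 * size (half (not b) C)
        ≡⟨ cong (_+ 2 * size (half (not b) C)) (sym (size-half-move-from b x C 2≤C)) ⟩
      size (half b C′) + 2 + 2 * size (half (not b) C)
        ≡⟨ regroup (size (half b C′)) (size (half (not b) C)) ⟩
      size (half b C′) + 2 * (size (half (not b) C) + 1)
        ≡⟨ cong (λ s → size (half b C′) + 2 * s) (sym to) ⟩
      size (half b C′) + 2 * size (half (not b) C′) ∎
      where open ≡-Reasoning
... | C″ , r , big = C″ , move-Step (zero , refl) 2≤C ◅ r , big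

size≤half+2*half : ∀ {d} b (C : Config (suc d)) →
  size C ≤ size (half b C) + 2 * size (half (not b) C)
size≤half+2*half b C =
  ≤-trans (≤-reflexive (size-split′ b C)) (+-monoʳ-≤ (size (half b C)) (m≤m+n _ _))

halves-≥ : ∀ {d} T → 2 ^ d ≤ T → (C : Config (suc d)) → 3 * T ≤ size C →
  ∃ λ C′ → Reachable C C′ × (∀ b → T ≤ size (half b C′))
halves-≥ T 2^d≤T C ≤size with size (half true C) ≤? T | size (half false C) ≤? T
... | yes s₁≤T | _ =
  fill-half T 2^d≤T false (T ∸ size (half true C)) C (m+[n∸m]≡n s₁≤T)
    (≤-trans ≤size (size≤half+2*half false C))
... | no _ | yes s₀≤T =
  fill-half T 2^d≤T true (T ∸ size (half false C)) C (m+[n∸m]≡n s₀≤T)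
    (≤-trans ≤size (size≤half+2*half true C))
... | no s₁≰T | no s₀≰T =
  C , ε , λ { false → ≰⇒≥ s₀≰T ; true → ≰⇒≥ s₁≰T }

coverable : ∀ d (C : Config d) → 3 ^ d ≤ size C → Coverable C
coverable zero    C ≤size = C , ε , λ { [] → subst (1 ≤_) (+-identityʳ (C [])) ≤size }
coverable (suc d) C ≤size with halves-≥ (3 ^ d) (^-monoˡ-≤ d (s≤s (s≤s z≤n))) C ≤size
... | C′ , r , big = Reachable-Coverable r (Coverable-halves (3 ^ d) (coverable d) C′ big)

theorem1 : ∀ (d : ℕ) → 1 ≤ d → IsCoverPebblingNumber d (3 ^ d)
theorem1 d _ = (λ C size≡ → coverable d C (≤-reflexive (sym size≡))) , ¬AllCoverable d
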